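{- Let $p$ be a prime with $p\equiv 1\pmod 4$ and let $i$ be a positive integer. Suppose $p+i$ has a divisor $d$ with $d\equiv 3\pmod 4$ such that $4i\mid (p+d)$. Then $4k:=(p+d)/i$ is a positive integer divisible by $4$, and there exist positive integers $x,y,z$ with $$\frac{4}{p}=\frac{1}{x}+\frac{1}{y}+\frac{1}{z},$$ obtained from the ceiling continued fraction expansion of $p/(4k)$, which has three coefficients, via $\frac{4k}{p}=\frac{1}{p_0}+\frac{1}{p_0p_1}+\frac{1}{p_1p_2}$ with $p_2=p$.
   Context: The ceiling continued fraction of a positive real $x$ is obtained by the Euclidean algorithm with the ceiling function: $c_0=\lceil x\rceil$, and while the current value $x_j$ differs from $c_j$, set $x_{j+1}=1/(c_j-x_j)$, $c_{j+1}=\lceil x_{j+1}\rceil$; then $x=c_0-1/(c_1-1/(c_2-\cdots))$. Its convergent numerators satisfy $p_j=c_jp_{j-1}-p_{j-2}$ with $p_{ -1}=1$, $p_{ -2}=0$. -}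

module Defs where

open import Data.Nat using (ℕ; zero; suc; _+_; _*_; _∸_; _≡ᵇ_; _/_)
open import Data.Bool using (if_then_else_)
open import Data.List using (List; []; _∷_)
open import Data.Integer as ℤ using (ℤ; +_; -[1+_])
import Data.Rational as ℚ
open ℚ using (ℚ; 0ℚ)

-- Ceiling continued fraction of the positive rational a/b (b > 0),
-- computed by the Euclidean algorithm with the ceiling function:
-- c = ⌈a/b⌉; stop if c = a/b, otherwise continue with b/(c*b - a).
-- Denominators strictly decrease, so fuel b+1 suffices.
-- For b = suc b', ⌈a / suc b'⌉ = (a + b') / suc b'.
ccfFuel : ℕ → ℕ → ℕ → List ℕ
ccfFuel zero    a b       = []
ccfFuel (suc f) a zero    = []
ccfFuel (suc f) a (suc b) =
  let c = (a + b) / suc b in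
  c ∷ (if c * suc b ≡ᵇ a then [] else ccfFuel f (suc b) (c * suc b ∸ a))

ceilCF : ℕ → ℕ → List ℕ
ceilCF a b = ccfFuel (suc b) a b

-- 1/n as a rational (only used for nonzero n; 1/0 := 0 by convention)
recip : ℕ → ℚ
recip zero    = 0ℚ
recip (suc n) = + 1 ℚ./ suc n

-- 1/z for an integer z (1/0 := 0 by convention)
recipℤ : ℤ → ℚ
recipℤ (+ zero)  = 0ℚ
recipℤ (+ suc n) = + 1 ℚ./ suc n
recipℤ -[1+ n ]  = -[1+ 0 ] ℚ./ suc n

-- Convergent numerators of a ceiling continued fraction [c₀, c₁, c₂]:
-- p_j = c_j p_{j-1} - p_{j-2}, with p_{-1} = 1, p_{-2} = 0.
convNum₀ : ℕ → ℤ
convNum₀ c₀ = + c₀ ℤ.* + 1 ℤ.- + 0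

convNum₁ : ℕ → ℕ → ℤ
convNum₁ c₀ c₁ = + c₁ ℤ.* convNum₀ c₀ ℤ.- + 1

convNum₂ : ℕ → ℕ → ℕ → ℤ
convNum₂ c₀ c₁ c₂ = + c₂ ℤ.* convNum₁ c₀ c₁ ℤ.- convNum₀ c₀

{-# OPTIONS --safe #-}

-- Put n = (p + d)/i = 4k, so that p = i n − d.  A common divisor of d and i divides p, and it
-- cannot be p, for then p ∣ i and p + d ≤ p + (p + i) ≤ 3i < 4i ≤ p + d.  So d is coprime to i, and
-- d ∣ (p + i) + d = i (n + 1) gives n + 1 = e d, where e ≥ 2 because d ≡ 3 but n + 1 ≡ 1 (mod 4).
-- Hence p/n = i − 1/(e − 1/d) with 1 < d < n: the ceiling continued fraction of p/n is [i, e, d],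
-- with convergent numerators i, a = e i − 1 and d a − i = p.  Clearing denominators,
-- n/p = 1/i + 1/(i a) + 1/(a p) becomes (p + d) a = a p + p + i, i.e. d a = p + i, and dividing
-- by k gives 4/p = 1/(k i) + 1/(k i a) + 1/(k a p).

module Submission where

open import Defs
open import Data.Nat
open import Data.Nat.Properties
open import Data.Nat.DivMod
open import Data.Nat.Divisibility
open import Data.Nat.Coprimality using (Coprime; coprime-divisor)
open import Data.Nat.Primality using (Prime; prime⇒irreducible; prime⇒nonZero)
open import Data.Nat.Tactic.RingSolver using (solve)
open import Data.Bool using (true; false; T; if_then_else_)
open import Data.Bool.Properties using (T-≡)
open import Data.List using (_∷_; [])
open import Data.Product using (_×_; _,_; ∃-syntax)
open import Data.Sum using (inj₁; inj₂)
open import Function.Bundles using (Equivalence)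
open import Relation.Nullary using (contradiction)
open import Relation.Binary.PropositionalEquality
open import Data.Integer as ℤ using (+_)
import Data.Integer.Properties as ℤ
open import Data.Rational.Unnormalised as ℚᵘ using (mkℚᵘ; *≡*)
import Data.Rational.Unnormalised.Properties as ℚᵘ
open import Data.Rational as ℚ using (ℚ; toℚᵘ)
open import Data.Rational.Properties using (toℚᵘ-injective; toℚᵘ-fromℚᵘ; toℚᵘ-homo-+; toℚᵘ-homo-*)

+-nonZeroˡ : ∀ m n .{{_ : NonZero m}} → NonZero (m + n)
+-nonZeroˡ (suc m) n = _

≢⇒≡ᵇ≡false : ∀ m n → m ≢ n → (m ≡ᵇ n) ≡ false
≢⇒≡ᵇ≡false m n m≢n with m ≡ᵇ n in eq
... | false = refl
... | true  = contradiction (≡ᵇ⇒≡ m n (subst T (sym eq) _)) m≢n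

[m*n+o]/n≡m : ∀ m n o .{{_ : NonZero n}} → o < n → (m * n + o) / n ≡ m
[m*n+o]/n≡m m n o o<n = begin
  (m * n + o) / n     ≡⟨ +-distrib-/-∣ˡ o (divides-refl m) ⟩
  m * n / n + o / n   ≡⟨ cong₂ _+_ (m*n/n≡m m n) (m<n⇒m/n≡0 o<n) ⟩
  m + 0               ≡⟨ +-identityʳ m ⟩
  m                   ∎
  where open ≡-Reasoning

ceil-quotient : ∀ {a b c r} → a + suc r ≡ c * suc b → r < b → (a + b) / suc b ≡ c
ceil-quotient {a} {b} {c} {r} a+1+r≡c*[1+b] r<b = begin
  (a + b) / suc b                 ≡⟨ cong (λ t → (a + t) / suc b) (sym (m+[n∸m]≡n r<b)) ⟩
  (a + (suc r + s)) / suc b       ≡⟨ cong (_/ suc b) (sym (+-assoc a (suc r) s)) ⟩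
  (a + suc r + s) / suc b         ≡⟨ cong (λ t → (t + s) / suc b) a+1+r≡c*[1+b] ⟩
  (c * suc b + s) / suc b         ≡⟨ [m*n+o]/n≡m c (suc b) s (s≤s (m∸n≤m b (suc r))) ⟩
  c                               ∎
  where
  s : ℕ
  s = b ∸ suc r

  open ≡-Reasoning

ccfFuel-step : ∀ f {a b c r} → a + suc r ≡ c * suc b → r < b →
               ccfFuel (suc f) a (suc b) ≡ c ∷ ccfFuel f (suc b) (suc r)
ccfFuel-step f {a} {b} {c} {r} a+1+r≡c*[1+b] r<b = begin
  ccfFuel (suc f) a (suc b)
    ≡⟨ cong (λ c′ → c′ ∷ (if c′ * suc b ≡ᵇ a then [] else ccfFuel f (suc b) (c′ * suc b ∸ a)))
            (ceil-quotient a+1+r≡c*[1+b] r<b) ⟩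
  c ∷ (if c * suc b ≡ᵇ a then [] else ccfFuel f (suc b) (c * suc b ∸ a))
    ≡⟨ cong (λ t → c ∷ (if t then [] else ccfFuel f (suc b) (c * suc b ∸ a)))
            (≢⇒≡ᵇ≡false (c * suc b) a c*[1+b]≢a) ⟩
  c ∷ ccfFuel f (suc b) (c * suc b ∸ a)
    ≡⟨ cong (λ t → c ∷ ccfFuel f (suc b) t) c*[1+b]∸a≡1+r ⟩
  c ∷ ccfFuel f (suc b) (suc r) ∎
  where
  c*[1+b]≢a : c * suc b ≢ a
  c*[1+b]≢a c*[1+b]≡a = m+1+n≢m a (trans a+1+r≡c*[1+b] c*[1+b]≡a)

  c*[1+b]∸a≡1+r : c * suc b ∸ a ≡ suc r
  c*[1+b]∸a≡1+r = trans (cong (_∸ a) (sym a+1+r≡c*[1+b])) (m+n∸m≡n a (suc r))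

  open ≡-Reasoning

ccfFuel-last : ∀ f a .{{_ : NonZero f}} → ccfFuel f a 1 ≡ a ∷ []
ccfFuel-last (suc f) a
  rewrite +-identityʳ a | n/1≡n a | *-identityʳ a
        | Equivalence.to T-≡ (≡⇒≡ᵇ a a refl)
        = refl

ceilCF-three : ∀ {p n c₀ c₁ d} → p + d ≡ c₀ * n → suc n ≡ c₁ * d → 1 < d → d < n →
               ceilCF p n ≡ c₀ ∷ c₁ ∷ d ∷ []
ceilCF-three {p} {suc n} {c₀} {c₁} {suc d} p+d≡c₀*n 1+n≡c₁*d (s≤s 0<d) (s≤s d<n) = begin
  ccfFuel (suc (suc n)) p (suc n)       ≡⟨ ccfFuel-step (suc n) p+d≡c₀*n d<n ⟩
  c₀ ∷ ccfFuel (suc n) (suc n) (suc d)  ≡⟨ cong (c₀ ∷_) (ccfFuel-step n {suc n} 2+n≡c₁*d 0<d) ⟩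
  c₀ ∷ c₁ ∷ ccfFuel n (suc d) 1         ≡⟨ cong (λ t → c₀ ∷ c₁ ∷ t) (ccfFuel-last n (suc d)) ⟩
  c₀ ∷ c₁ ∷ suc d ∷ []                  ∎
  where
  open ≡-Reasoning

  2+n≡c₁*d : suc n + 1 ≡ c₁ * suc d
  2+n≡c₁*d = trans (+-comm (suc n) 1) 1+n≡c₁*d

  instance
    n≢0 : NonZero n
    n≢0 = >-nonZero (<-trans 0<d d<n)

-- qⱼ is the convergent numerator pⱼ; the letter p is reserved for the prime.
convNum₀≡ : ∀ c₀ → convNum₀ c₀ ≡ + c₀
convNum₀≡ c₀ = trans (ℤ.+-identityʳ (+ c₀ ℤ.* + 1)) (ℤ.*-identityʳ (+ c₀))

convNum₁≡ : ∀ {c₀ c₁ q₁} → c₁ * c₀ ≡ suc q₁ → convNum₁ c₀ c₁ ≡ + q₁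
convNum₁≡ {c₀} {c₁} {q₁} c₁*c₀≡1+q₁ = begin
  + c₁ ℤ.* convNum₀ c₀ ℤ.- + 1   ≡⟨ cong (λ t → + c₁ ℤ.* t ℤ.- + 1) (convNum₀≡ c₀) ⟩
  + c₁ ℤ.* + c₀ ℤ.- + 1          ≡⟨ cong (ℤ._- + 1) (sym (ℤ.pos-* c₁ c₀)) ⟩
  + (c₁ * c₀) ℤ.- + 1            ≡⟨ cong (λ t → + t ℤ.- + 1) c₁*c₀≡1+q₁ ⟩
  + q₁                           ∎
  where open ≡-Reasoning

convNum₂≡ : ∀ {c₀ c₁ c₂ q₁ q₂} → c₁ * c₀ ≡ suc q₁ → c₂ * q₁ ≡ q₂ + c₀ → convNum₂ c₀ c₁ c₂ ≡ + q₂
convNum₂≡ {c₀} {c₁} {c₂} {q₁} {q₂} c₁*c₀≡1+q₁ c₂*q₁≡q₂+c₀ = begin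
  + c₂ ℤ.* convNum₁ c₀ c₁ ℤ.- convNum₀ c₀
    ≡⟨ cong₂ (λ s t → + c₂ ℤ.* s ℤ.- t) (convNum₁≡ {c₀} {c₁} {q₁} c₁*c₀≡1+q₁) (convNum₀≡ c₀) ⟩
  + c₂ ℤ.* + q₁ ℤ.- + c₀                  ≡⟨ cong (ℤ._- + c₀) (sym (ℤ.pos-* c₂ q₁)) ⟩
  + (c₂ * q₁) ℤ.- + c₀                    ≡⟨ cong (λ t → + t ℤ.- + c₀) c₂*q₁≡q₂+c₀ ⟩
  + (q₂ + c₀) ℤ.- + c₀                    ≡⟨ ℤ.[+m]-[+n]≡m⊖n (q₂ + c₀) c₀ ⟩
  (q₂ + c₀) ℤ.⊖ c₀                        ≡⟨ ℤ.⊖-≥ (m≤n+m c₀ q₂) ⟩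
  + (q₂ + c₀ ∸ c₀)                        ≡⟨ cong +_ (m+n∸n≡m q₂ c₀) ⟩
  + q₂                                    ∎
  where open ≡-Reasoning

recipℤ-+ : ∀ n → recipℤ (+ n) ≡ recip n
recipℤ-+ zero    = refl
recipℤ-+ (suc n) = refl

recipℤ-pos-sum : ∀ {u v w a b c} → u ≡ + a → v ≡ + b → w ≡ + c →
  recipℤ u ℚ.+ recipℤ (u ℤ.* v) ℚ.+ recipℤ (v ℤ.* w) ≡ recip a ℚ.+ recip (a * b) ℚ.+ recip (b * c)
recipℤ-pos-sum {a = a} {b} {c} refl refl refl
  rewrite sym (ℤ.pos-* a b) | sym (ℤ.pos-* b c)
        | recipℤ-+ a | recipℤ-+ (a * b) | recipℤ-+ (b * c)
        = refl

-- m/p = 1/x + 1/y + 1/z, multiplied through by p x y z.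
Egyptian₃ : ℕ → ℕ → ℕ → ℕ → ℕ → Set
Egyptian₃ m p x y z = m * (x * y * z) ≡ p * (y * z + x * z + x * y)

Egyptian₃⇒sum-of-recips : ∀ m p x y z .{{_ : NonZero m}} .{{_ : NonZero p}}
  .{{_ : NonZero x}} .{{_ : NonZero y}} .{{_ : NonZero z}} →
  Egyptian₃ m p x y z → (+ m ℚ./ 1) ℚ.* recip p ≡ recip x ℚ.+ recip y ℚ.+ recip z
Egyptian₃⇒sum-of-recips m@(suc _) p@(suc p′) x@(suc x′) y@(suc y′) z@(suc z′) eq =
  toℚᵘ-injective (begin
    toℚᵘ (M ℚ.* P)                            ≈⟨ toℚᵘ-homo-* M P ⟩
    toℚᵘ M ℚᵘ.* toℚᵘ P                        ≈⟨ ℚᵘ.*-cong (toℚᵘ-fromℚᵘ (mkℚᵘ (+ m) 0)) (toℚᵘ-recip p′) ⟩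
    mkℚᵘ (+ m) 0 ℚᵘ.* mkℚᵘ (+ 1) p′           ≈⟨ *≡* (cong +_ cross-multiplied) ⟩
    mkℚᵘ (+ 1) x′ ℚᵘ.+ mkℚᵘ (+ 1) y′ ℚᵘ.+ mkℚᵘ (+ 1) z′
      ≈⟨ ℚᵘ.+-cong (ℚᵘ.+-cong (toℚᵘ-recip x′) (toℚᵘ-recip y′)) (toℚᵘ-recip z′) ⟨
    toℚᵘ X ℚᵘ.+ toℚᵘ Y ℚᵘ.+ toℚᵘ Z            ≈⟨ ℚᵘ.+-cong (toℚᵘ-homo-+ X Y) ℚᵘ.≃-refl ⟨
    toℚᵘ (X ℚ.+ Y) ℚᵘ.+ toℚᵘ Z                ≈⟨ toℚᵘ-homo-+ (X ℚ.+ Y) Z ⟨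
    toℚᵘ (X ℚ.+ Y ℚ.+ Z)                      ∎)
  where
  M P X Y Z : ℚ
  M = + m ℚ./ 1
  P = recip p
  X = recip x
  Y = recip y
  Z = recip z

  -- the form to which the cross-multiplied ℚᵘ equation reduces
  cross-multiplied : m * 1 * (x * y * z) ≡ ((1 * y + 1 * x) * z + 1 * (x * y)) * (1 * p)
  cross-multiplied = begin
    m * 1 * (x * y * z)                            ≡⟨ cong (_* (x * y * z)) (*-identityʳ m) ⟩
    m * (x * y * z)                                ≡⟨ eq ⟩
    p * (y * z + x * z + x * y)                    ≡⟨ solve (p′ ∷ x′ ∷ y′ ∷ z′ ∷ []) ⟩
    ((1 * y + 1 * x) * z + 1 * (x * y)) * (1 * p)  ∎
    where open ≡-Reasoning

  toℚᵘ-recip : ∀ n → toℚᵘ (recip (suc n)) ℚᵘ.≃ mkℚᵘ (+ 1) n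
  toℚᵘ-recip n = toℚᵘ-fromℚᵘ (mkℚᵘ (+ 1) n)

  open ℚᵘ.≃-Reasoning

Egyptian₃-scale : ∀ k m p x y z → Egyptian₃ (k * m) p x y z → Egyptian₃ m p (k * x) (k * y) (k * z)
Egyptian₃-scale k m p x y z eq = begin
  m * (k * x * (k * y) * (k * z))                            ≡⟨ solve (k ∷ m ∷ x ∷ y ∷ z ∷ []) ⟩
  k * k * (k * m * (x * y * z))                              ≡⟨ cong ((k * k) *_) eq ⟩
  k * k * (p * (y * z + x * z + x * y))                      ≡⟨ solve (k ∷ p ∷ x ∷ y ∷ z ∷ []) ⟩
  p * (k * y * (k * z) + k * x * (k * z) + k * x * (k * y))  ∎
  where open ≡-Reasoning

unitFractions-of-multiple : ∀ k m p x y z .{{_ : NonZero k}} .{{_ : NonZero m}} .{{_ : NonZero p}}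
  .{{_ : NonZero x}} .{{_ : NonZero y}} .{{_ : NonZero z}} →
  Egyptian₃ (k * m) p x y z →
  ∃[ x′ ] ∃[ y′ ] ∃[ z′ ] (0 < x′ × 0 < y′ × 0 < z′
    × (+ m ℚ./ 1) ℚ.* recip p ≡ recip x′ ℚ.+ recip y′ ℚ.+ recip z′)
unitFractions-of-multiple k m p x y z eq =
  k * x , k * y , k * z , >-nonZero⁻¹ (k * x) , >-nonZero⁻¹ (k * y) , >-nonZero⁻¹ (k * z) ,
  Egyptian₃⇒sum-of-recips m p (k * x) (k * y) (k * z) (Egyptian₃-scale k m p x y z eq)
  where
  instance
    k*x≢0 : NonZero (k * x)
    k*x≢0 = m*n≢0 k x

    k*y≢0 : NonZero (k * y)
    k*y≢0 = m*n≢0 k y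

    k*z≢0 : NonZero (k * z)
    k*z≢0 = m*n≢0 k z

convergent-numerator-identity : ∀ {p n c₀ c₁ d q₁} →
  p + d ≡ c₀ * n → suc n ≡ c₁ * d → c₁ * c₀ ≡ suc q₁ → d * q₁ ≡ p + c₀
convergent-numerator-identity {p} {n} {c₀} {c₁} {d} {q₁} p+d≡c₀*n 1+n≡c₁*d c₁*c₀≡1+q₁ =
  +-cancelʳ-≡ d (d * q₁) (p + c₀) (begin
    d * q₁ + d          ≡⟨ solve (d ∷ q₁ ∷ []) ⟩
    d * suc q₁          ≡⟨ cong (d *_) c₁*c₀≡1+q₁ ⟨
    d * (c₁ * c₀)       ≡⟨ solve (d ∷ c₁ ∷ c₀ ∷ []) ⟩
    c₁ * d * c₀         ≡⟨ cong (_* c₀) 1+n≡c₁*d ⟨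
    suc n * c₀          ≡⟨ solve (n ∷ c₀ ∷ []) ⟩
    c₀ * n + c₀         ≡⟨ cong (_+ c₀) p+d≡c₀*n ⟨
    p + d + c₀          ≡⟨ solve (p ∷ d ∷ c₀ ∷ []) ⟩
    p + c₀ + d          ∎)
  where open ≡-Reasoning

convergent-Egyptian₃ : ∀ {p n c₀ d q₁} → p + d ≡ c₀ * n → d * q₁ ≡ p + c₀ →
  Egyptian₃ n p c₀ (c₀ * q₁) (q₁ * p)
convergent-Egyptian₃ {p} {n} {c₀} {d} {q₁} p+d≡c₀*n d*q₁≡p+c₀ = begin
  n * (c₀ * (c₀ * q₁) * (q₁ * p))                          ≡⟨ solve (n ∷ p ∷ c₀ ∷ q₁ ∷ []) ⟩
  c₀ * q₁ * p * (n * c₀ * q₁)                              ≡⟨ cong ((c₀ * q₁ * p) *_) n*c₀*q₁≡q₁*p+p+c₀ ⟩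
  c₀ * q₁ * p * (q₁ * p + p + c₀)                          ≡⟨ solve (p ∷ c₀ ∷ q₁ ∷ []) ⟩
  p * (c₀ * q₁ * (q₁ * p) + c₀ * (q₁ * p) + c₀ * (c₀ * q₁)) ∎
  where
  open ≡-Reasoning

  n*c₀*q₁≡q₁*p+p+c₀ : n * c₀ * q₁ ≡ q₁ * p + p + c₀
  n*c₀*q₁≡q₁*p+p+c₀ = begin
    n * c₀ * q₁         ≡⟨ cong (_* q₁) (*-comm n c₀) ⟩
    c₀ * n * q₁         ≡⟨ cong (_* q₁) p+d≡c₀*n ⟨
    (p + d) * q₁        ≡⟨ solve (p ∷ d ∷ q₁ ∷ []) ⟩
    q₁ * p + d * q₁     ≡⟨ cong (λ t → q₁ * p + t) d*q₁≡p+c₀ ⟩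
    q₁ * p + (p + c₀)   ≡⟨ +-assoc (q₁ * p) p c₀ ⟨
    q₁ * p + p + c₀     ∎

ThreeTermCeilCF : ℕ → ℕ → Set
ThreeTermCeilCF p n = ∃[ c₀ ] ∃[ c₁ ] ∃[ c₂ ]
  (ceilCF p n ≡ c₀ ∷ c₁ ∷ c₂ ∷ []
   × convNum₂ c₀ c₁ c₂ ≡ + p
   × (+ n ℚ./ 1) ℚ.* recip p
       ≡ recipℤ (convNum₀ c₀) ℚ.+ recipℤ (convNum₀ c₀ ℤ.* convNum₁ c₀ c₁)
         ℚ.+ recipℤ (convNum₁ c₀ c₁ ℤ.* convNum₂ c₀ c₁ c₂))

-- The hypotheses say p/n = c₀ − 1/(c₁ − 1/d).
module ThreeTermExpansion {p n c₀ c₁ d : ℕ} .{{_ : NonZero p}}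
  (p+d≡c₀*n : p + d ≡ c₀ * n) (1+n≡c₁*d : suc n ≡ c₁ * d) (1<d : 1 < d) (d<n : d < n) where

  instance
    n≢0 : NonZero n
    n≢0 = >-nonZero (m<n⇒0<n d<n)

    c₀≢0 : NonZero c₀
    c₀≢0 = m*n≢0⇒m≢0 c₀ {{subst NonZero p+d≡c₀*n (+-nonZeroˡ p d)}}

    c₁≢0 : NonZero c₁
    c₁≢0 = m*n≢0⇒m≢0 c₁ {{subst NonZero 1+n≡c₁*d _}}

  q₁ : ℕ
  q₁ = pred (c₁ * c₀)

  c₁*c₀≡1+q₁ : c₁ * c₀ ≡ suc q₁
  c₁*c₀≡1+q₁ = sym (suc-pred (c₁ * c₀) {{m*n≢0 c₁ c₀}})

  d*q₁≡p+c₀ : d * q₁ ≡ p + c₀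
  d*q₁≡p+c₀ =
    convergent-numerator-identity {p} {n} {c₀} {c₁} {d} {q₁} p+d≡c₀*n 1+n≡c₁*d c₁*c₀≡1+q₁

  instance
    q₁≢0 : NonZero q₁
    q₁≢0 = m*n≢0⇒n≢0 d {{subst NonZero (sym d*q₁≡p+c₀) (+-nonZeroˡ p c₀)}}

    c₀*q₁≢0 : NonZero (c₀ * q₁)
    c₀*q₁≢0 = m*n≢0 c₀ q₁

    q₁*p≢0 : NonZero (q₁ * p)
    q₁*p≢0 = m*n≢0 q₁ p

  egyptian : Egyptian₃ n p c₀ (c₀ * q₁) (q₁ * p)
  egyptian = convergent-Egyptian₃ {p} {n} {c₀} {d} {q₁} p+d≡c₀*n d*q₁≡p+c₀

  ceilCF≡ : ceilCF p n ≡ c₀ ∷ c₁ ∷ d ∷ []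
  ceilCF≡ = ceilCF-three p+d≡c₀*n 1+n≡c₁*d 1<d d<n

  convNum₂≡p : convNum₂ c₀ c₁ d ≡ + p
  convNum₂≡p = convNum₂≡ {c₀} {c₁} {d} {q₁} {p} c₁*c₀≡1+q₁ d*q₁≡p+c₀

  convergent-expansion : (+ n ℚ./ 1) ℚ.* recip p
    ≡ recipℤ (convNum₀ c₀) ℚ.+ recipℤ (convNum₀ c₀ ℤ.* convNum₁ c₀ c₁)
      ℚ.+ recipℤ (convNum₁ c₀ c₁ ℤ.* convNum₂ c₀ c₁ d)
  convergent-expansion =
    trans (Egyptian₃⇒sum-of-recips n p c₀ (c₀ * q₁) (q₁ * p) egyptian)
          (sym (recipℤ-pos-sum (convNum₀≡ c₀) (convNum₁≡ {c₀} {c₁} {q₁} c₁*c₀≡1+q₁) convNum₂≡p))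

  expansion : ThreeTermCeilCF p n
  expansion = c₀ , c₁ , d , ceilCF≡ , convNum₂≡p , convergent-expansion

∣p+i⇒coprime : ∀ {p i d} .{{_ : NonZero i}} → Prime p → d ∣ p + i → 3 * i < p + d → Coprime d i
∣p+i⇒coprime {p} {i} {d} p-prime d∣p+i 3i<p+d {c} (c∣d , c∣i)
  with prime⇒irreducible p-prime
         (∣m+n∣m⇒∣n (subst (c ∣_) (+-comm p i) (∣-trans c∣d d∣p+i)) c∣i)
... | inj₁ c≡1 = c≡1
... | inj₂ refl = contradiction 3i<p+d (≤⇒≯ p+d≤3i)
  where
  instance
    p≢0 : NonZero p
    p≢0 = prime⇒nonZero p-prime

  p≤i : p ≤ i
  p≤i = ∣⇒≤ c∣i

  p+d≤3i : p + d ≤ 3 * i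
  p+d≤3i = begin
    p + d         ≤⟨ +-monoʳ-≤ p (∣⇒≤ {{+-nonZeroˡ p i}} d∣p+i) ⟩
    p + (p + i)   ≤⟨ +-mono-≤ p≤i (+-monoˡ-≤ i p≤i) ⟩
    i + (i + i)   ≡⟨ solve (i ∷ []) ⟩
    3 * i         ∎
    where open ≤-Reasoning

coprime⇒∣suc-quotient : ∀ {p i d n} → Coprime d i → d ∣ p + i → p + d ≡ i * n → d ∣ suc n
coprime⇒∣suc-quotient {p} {i} {d} {n} coprime d∣p+i p+d≡i*n =
  coprime-divisor coprime (subst (d ∣_) p+i+d≡i*[1+n] (∣m∣n⇒∣m+n d∣p+i ∣-refl))
  where
  p+i+d≡i*[1+n] : p + i + d ≡ i * suc n
  p+i+d≡i*[1+n] = begin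
    p + i + d     ≡⟨ solve (p ∷ i ∷ d ∷ []) ⟩
    p + d + i     ≡⟨ cong (_+ i) p+d≡i*n ⟩
    i * n + i     ≡⟨ solve (i ∷ n ∷ []) ⟩
    i * suc n     ∎
    where open ≡-Reasoning

proper-divisor< : ∀ {n d} → d ∣ suc n → d ≢ suc n → 1 < d → d < n
proper-divisor< (divides zero ())
proper-divisor< {n} {d} (divides (suc zero) 1+n≡1*d) d≢1+n _ =
  contradiction (sym (trans 1+n≡1*d (+-identityʳ d))) d≢1+n
proper-divisor< {n} {d} (divides (suc (suc e)) 1+n≡[2+e]*d) _ 1<d =
  +-cancelˡ-≤ 1 (suc d) n (begin
    suc (suc d)       ≤⟨ +-monoˡ-≤ d 1<d ⟩
    d + d             ≤⟨ +-monoʳ-≤ d (m≤m+n d (e * d)) ⟩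
    d + (d + e * d)   ≡⟨ 1+n≡[2+e]*d ⟨
    suc n             ∎)
  where open ≤-Reasoning

%4≡3⇒≢1+4k : ∀ k {d} → d % 4 ≡ 3 → d ≢ suc (k * 4)
%4≡3⇒≢1+4k k d%4≡3 d≡1+4k =
  contradiction (trans (sym d%4≡3) (trans (cong (_% 4) d≡1+4k) ([m+kn]%n≡m%n 1 k 4))) λ ()

theorem2p3 : (p i d : ℕ) → .{{_ : NonZero i}} → Prime p → p % 4 ≡ 1 →
    d ∣ p + i → d % 4 ≡ 3 → (4 * i) ∣ p + d →
    (0 < (p + d) / i × 4 ∣ (p + d) / i)
    × (∃[ c₀ ] ∃[ c₁ ] ∃[ c₂ ]
         (ceilCF p ((p + d) / i) ≡ c₀ ∷ c₁ ∷ c₂ ∷ []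
          × convNum₂ c₀ c₁ c₂ ≡ + p
          × (+ ((p + d) / i) ℚ./ 1) ℚ.* recip p
              ≡ recipℤ (convNum₀ c₀) ℚ.+ recipℤ (convNum₀ c₀ ℤ.* convNum₁ c₀ c₁)
                ℚ.+ recipℤ (convNum₁ c₀ c₁ ℤ.* convNum₂ c₀ c₁ c₂)))
    × (∃[ x ] ∃[ y ] ∃[ z ] (0 < x × 0 < y × 0 < z
         × (+ 4 ℚ./ 1) ℚ.* recip p ≡ recip x ℚ.+ recip y ℚ.+ recip z))
theorem2p3 p i d p-prime _ d∣p+i d%4≡3 (divides k p+d≡k*[4*i]) =
  (subst (0 <_) (sym n≡k*4) (>-nonZero⁻¹ (k * 4)) , divides k n≡k*4) ,
  subst (ThreeTermCeilCF p) (sym n≡k*4) expansion ,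
  unitFractions-of-multiple k 4 p i (i * q₁) (q₁ * p) egyptian
  where
  instance
    p≢0 : NonZero p
    p≢0 = prime⇒nonZero p-prime

    k≢0 : NonZero k
    k≢0 = m*n≢0⇒m≢0 k {{subst NonZero p+d≡k*[4*i] (+-nonZeroˡ p d)}}

  p+d≡i*[k*4] : p + d ≡ i * (k * 4)
  p+d≡i*[k*4] = trans p+d≡k*[4*i] (trans (sym (*-assoc k 4 i)) (*-comm (k * 4) i))

  n≡k*4 : (p + d) / i ≡ k * 4
  n≡k*4 = trans (cong (_/ i) (trans p+d≡i*[k*4] (*-comm i (k * 4)))) (m*n/n≡m (k * 4) i)

  3i<p+d : 3 * i < p + d
  3i<p+d = <-≤-trans (*-monoˡ-< i (n<1+n 3))
                     (subst (4 * i ≤_) (sym p+d≡k*[4*i]) (m≤n*m (4 * i) k))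

  d∣1+4k : d ∣ suc (k * 4)
  d∣1+4k = coprime⇒∣suc-quotient (∣p+i⇒coprime p-prime d∣p+i 3i<p+d) d∣p+i p+d≡i*[k*4]

  1<d : 1 < d
  1<d = <⇒≤ (subst (_≤ d) d%4≡3 (m%n≤m d 4))

  open ThreeTermExpansion {p} {k * 4} {i} {_∣_.quotient d∣1+4k} {d} p+d≡i*[k*4] (_∣_.equality d∣1+4k)
    1<d (proper-divisor< d∣1+4k (%4≡3⇒≢1+4k k d%4≡3) 1<d)
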